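{- For all positive integers $n$ and all $r\in\mathbb{N}$, the statistics $\operatorname{veh}$ and $\operatorname{des}$ have the same distribution over $\mathfrak{S}_n^r$.
   Context: Stack-sorting: $S$ of the empty word is empty, and for a nonempty word $w=LmR$ with $m$ its greatest letter, $S(w)=S(L)S(R)m$. $\mathfrak{S}_n^r$ is the set of $\pi\in\mathfrak{S}_n$ with $S^r(\pi)=12\cdots n$. For $\pi=a_1\cdots a_n$, $\operatorname{des}(\pi)=|\{i\in[n-1]:a_i>a_{i+1}\}|$. The unordered decreasing tree $T(w;m)$ of a word $w$ with distinct letters less than $m$: if $w$ is empty it is a single vertex labeled $m$; otherwise write $w=m_1w_1\cdots m_kw_k$ with $m_1,\dots,m_k$ the left-to-right maxima of $w$, and $T(w;m)$ has root $m$ with subtrees $T(w_1;m_1),\dots,T(w_k;m_k)$. With $\infty$ larger than all letters, $\operatorname{veh}(\pi)$ is the number of non-root vertices of $T(\pi;\infty)$ at even distance from the root. -}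

module Defs where

open import Data.Nat using (ℕ; zero; suc; _+_; _<ᵇ_; _≡ᵇ_; _⊔_)
open import Data.Nat.Properties using () renaming (_≟_ to _≟ℕ_)
open import Data.Bool using (Bool; true; false; if_then_else_; _∧_; not)
open import Data.List using (List; []; _∷_; _++_; length; map; concatMap; takeWhile; dropWhile; sum; filter; foldr)
open import Data.Product using (_×_; _,_)
open import Relation.Nullary.Decidable using (⌊_⌋)
open import Relation.Unary using (Decidable)
open import Relation.Binary.PropositionalEquality using (_≡_)
import Data.List.Properties as LP
open import Data.Nat using (_<?_)

-- Words are lists of natural numbers (letters); permutations of [n] are
-- words containing each of 1,…,n exactly once.

idPerm : ℕ → List ℕ
idPerm zero = []
idPerm (suc n) = idPerm n ++ (suc n ∷ [])

insertions : ℕ → List ℕ → List (List ℕ)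
insertions x [] = (x ∷ []) ∷ []
insertions x (y ∷ ys) = (x ∷ y ∷ ys) ∷ map (y ∷_) (insertions x ys)

-- 𝔖ₙ : all permutations of [n] (each exactly once), built by inserting n
perms : ℕ → List (List ℕ)
perms zero = [] ∷ []
perms (suc n) = concatMap (insertions (suc n)) (perms n)

-- greatest letter of a word (0 for the empty word; letters are positive)
maxL : List ℕ → ℕ
maxL = foldr _⊔_ 0

splitAtLetter : ℕ → List ℕ → List ℕ × List ℕ
splitAtLetter m [] = [] , []
splitAtLetter m (x ∷ xs) with x ≡ᵇ m
... | true = [] , xs
... | false with splitAtLetter m xs
...   | (L , R) = (x ∷ L) , R

-- stack-sorting map with fuel; fuel = length w suffices, since |L|,|R| < |w|
S′ : ℕ → List ℕ → List ℕ
S′ zero w = []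
S′ (suc f) [] = []
S′ (suc f) (x ∷ xs) with splitAtLetter (maxL (x ∷ xs)) (x ∷ xs)
... | (L , R) = S′ f L ++ S′ f R ++ (maxL (x ∷ xs) ∷ [])

-- S(∅) = ∅,  S(L m R) = S(L) S(R) m
S : List ℕ → List ℕ
S w = S′ (length w) w

iterate : ℕ → (List ℕ → List ℕ) → List ℕ → List ℕ
iterate zero g w = w
iterate (suc r) g w = g (iterate r g w)

isSorted? : ℕ → List ℕ → Bool
isSorted? n w = ⌊ LP.≡-dec _≟ℕ_ w (idPerm n) ⌋

Snr : ℕ → ℕ → List (List ℕ)
Snr n r = filter (λ π → isSorted? n (iterate r S π) Data.Bool.≟ true) (perms n)
  where import Data.Bool

des : List ℕ → ℕ
des [] = 0
des (x ∷ []) = 0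
des (x ∷ y ∷ ys) = (if y <ᵇ x then 1 else 0) + des (y ∷ ys)

data Label : Set where
  fin : ℕ → Label
  ∞   : Label

data Tree : Set where
  node : Label → List Tree → Tree

-- decomposition w = m₁w₁⋯mₖwₖ with m₁,…,mₖ the left-to-right maxima
-- (fuel = length w suffices)
blocks′ : ℕ → List ℕ → List (ℕ × List ℕ)
blocks′ zero w = []
blocks′ (suc f) [] = []
blocks′ (suc f) (x ∷ rest) =
  (x , takeWhile (λ y → y <? x) rest) ∷ blocks′ f (dropWhile (λ y → y <? x) rest)

blocks : List ℕ → List (ℕ × List ℕ)
blocks w = blocks′ (length w) w

-- T(w; m) with fuel (fuel = length w suffices: each wᵢ is shorter than w)
T′ : ℕ → List ℕ → Label → Tree
T′ zero w m = node m []
T′ (suc f) w m = node m (map (λ { (mi , wi) → T′ f wi (fin mi) }) (blocks w))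

T : List ℕ → Label → Tree
T w m = T′ (length w) w m

even : ℕ → Bool
even zero = true
even (suc n) = not (even n)

mutual
  evenNonRoot : ℕ → Tree → ℕ
  evenNonRoot d (node _ ts) =
    (if even d ∧ not (d ≡ᵇ 0) then 1 else 0) + evenNonRootF (suc d) ts

  evenNonRootF : ℕ → List Tree → ℕ
  evenNonRootF d [] = 0
  evenNonRootF d (t ∷ ts) = evenNonRoot d t + evenNonRootF d ts

veh : List ℕ → ℕ
veh π = evenNonRoot 0 (T π ∞)

countStat : (List ℕ → ℕ) → ℕ → List (List ℕ) → ℕ
countStat st k ps = length (filter (λ π → st π Data.Nat.≟ k) ps)
  where import Data.Nat

-- Cutting a word at its largest letter, w = L m R, and recursing on L and R gives the decreasing
-- binary tree of w, whose in-order reading is w and whose postorder reading is S(w).  Descents of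
-- w sit at the vertices with a right child, and veh(w) counts the vertices with an odd number of
-- right edges above them.  Let ι swap the two subtrees at every vertex with at most one child,
-- and φ(L m R) = φ(L) m ι(φ(R)).  Both keep the postorder reading, so φ, being invertible,
-- permutes 𝔖ₙʳ.  As ι turns left edges into right edges, ι(s) and s together have |s| − 1 right
-- edges, which yields des(φ(w)) = veh(w) by induction.

module Submission where

open import Defs
open import Data.Bool using (Bool; true; false; if_then_else_; _∧_; not)
open import Data.Bool.Properties using (T-≡)
open import Data.Empty using (⊥-elim)
open import Data.Nat using (ℕ; zero; suc; _+_; _≤_; _<_; _≟_; _<?_; _≡ᵇ_; _<ᵇ_; z≤n; s≤s)
open import Data.Nat.Properties
open import Data.Nat.Tactic.RingSolver using (solve-∀)
open import Data.List using (List; []; _∷_; _++_; length; map; filter; concatMap; takeWhile; dropWhile)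
open import Data.List.Properties
  using (length-++; map-++; map-∘; map-id-local; ∷-injectiveˡ; ∷-injectiveʳ; ++-identityʳ;
         foldr-forcesᵇ; foldr-preservesᵇ; takeWhile++dropWhile; filter-accept; filter-reject; filter-all)
open import Data.List.Relation.Unary.All as All using (All; []; _∷_)
import Data.List.Relation.Unary.All.Properties as All
open import Data.List.Relation.Unary.Any using (here; there)
open import Data.List.Membership.Propositional using (_∈_; _∉_; find; lose)
open import Data.List.Membership.Propositional.Properties
  using (∈-map⁻; ∈-map⁺; ∈-concatMap⁻; ∈-concatMap⁺; ∈-∃++; ∈-++⁺ʳ; ∈-filter⁻; ∈-filter⁺)
open import Data.List.Membership.Propositional.Properties.WithK using (unique∧set⇒bag)
open import Data.List.Relation.Unary.Unique.Propositional using (Unique; []; _∷_)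
import Data.List.Relation.Unary.Unique.Propositional.Properties as Unique
open import Data.List.Relation.Binary.Permutation.Propositional
  using (_↭_; ↭-refl; ↭-sym; ↭-trans; ↭-reflexive; prep; swap; ↭⇒↭ₛ)
import Data.List.Relation.Binary.Permutation.Propositional.Properties as ↭
open import Data.List.Relation.Binary.BagAndSetEquality using (∼bag⇒↭)
open import Data.Product using (_×_; _,_; proj₁; proj₂)
open import Data.Sum using (inj₁; inj₂)
open import Data.Unit using (⊤; tt)
open import Function using (_∘_; _⇔_; mk⇔; Equivalence)
open import Relation.Nullary using (¬_; yes; no; ¬?; does)
open import Relation.Nullary.Decidable using (toWitness; fromWitness)
open import Relation.Nullary.Reflects using (Reflects; ofʸ; ofⁿ; fromEquivalence)
open import Relation.Unary using (Decidable)
open import Relation.Binary.PropositionalEquality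
open import Data.List.Relation.Binary.Permutation.Setoid.Properties (setoid ℕ)
  using () renaming (Unique-resp-↭ to Unique-resp-↭ₛ)

suc-+-≤ : ∀ a b {f} → suc (a + b) ≤ suc f → a ≤ f × b ≤ f
suc-+-≤ a b (s≤s a+b≤f) = m+n≤o⇒m≤o a a+b≤f , m+n≤o⇒n≤o a a+b≤f

length-++-∷ : ∀ {A : Set} (L : List A) {m} R → length (L ++ m ∷ R) ≡ suc (length L + length R)
length-++-∷ L R = trans (length-++ L) (+-suc (length L) (length R))

-- Decreasing binary trees

data BinTree : Set where
  leaf : BinTree
  bin  : BinTree → ℕ → BinTree → BinTree

inorder : BinTree → List ℕ
inorder leaf        = []
inorder (bin l m r) = inorder l ++ m ∷ inorder r

postorder : BinTree → List ℕ
postorder leaf        = []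
postorder (bin l m r) = postorder l ++ postorder r ++ m ∷ []

size : BinTree → ℕ
size leaf        = 0
size (bin l m r) = suc (size l + size r)

length-inorder : ∀ t → length (inorder t) ≡ size t
length-inorder leaf        = refl
length-inorder (bin l m r) =
  trans (length-++-∷ (inorder l) (inorder r)) (cong₂ (λ a b → suc (a + b)) (length-inorder l) (length-inorder r))

Decreasing : BinTree → Set
Decreasing leaf        = ⊤
Decreasing (bin l m r) = All (_< m) (inorder l) × All (_< m) (inorder r) × Decreasing l × Decreasing r

xs≤maxL : ∀ xs → All (_≤ maxL xs) xs
xs≤maxL xs = foldr-forcesᵇ (λ x y x⊔y≤ → m⊔n≤o⇒m≤o x y x⊔y≤ , m⊔n≤o⇒n≤o x y x⊔y≤) 0 xs ≤-refl

maxL≤ : ∀ {m} xs → All (_≤ m) xs → maxL xs ≤ m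
maxL≤ xs = foldr-preservesᵇ ⊔-lub z≤n

maxL∈ : ∀ x xs → maxL (x ∷ xs) ∈ x ∷ xs
maxL∈ x []       = here (⊔-identityʳ x)
maxL∈ x (y ∷ ys) with ⊔-sel x (maxL (y ∷ ys))
... | inj₁ x⊔≡x = here x⊔≡x
... | inj₂ x⊔≡m = there (subst (_∈ y ∷ ys) (sym x⊔≡m) (maxL∈ y ys))

maxL≡ : ∀ {m xs} → m ∈ xs → All (_≤ m) xs → maxL xs ≡ m
maxL≡ {xs = xs} m∈xs xs≤m = ≤-antisym (maxL≤ xs xs≤m) (All.lookup (xs≤maxL xs) m∈xs)

≡ᵇ-reflects-≡ : ∀ m n → Reflects (m ≡ n) (m ≡ᵇ n)
≡ᵇ-reflects-≡ m n = fromEquivalence (≡ᵇ⇒≡ m n) (≡⇒≡ᵇ m n)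

splitAtLetter-∈ : ∀ {m} w → m ∈ w →
  proj₁ (splitAtLetter m w) ++ m ∷ proj₂ (splitAtLetter m w) ≡ w
splitAtLetter-∈ {m} (x ∷ xs) m∈w with x ≡ᵇ m | ≡ᵇ-reflects-≡ x m | m∈w
... | true  | ofʸ refl | _           = refl
... | false | ofⁿ x≢m | here m≡x    = ⊥-elim (x≢m (sym m≡x))
... | false | ofⁿ _   | there m∈xs = cong (x ∷_) (splitAtLetter-∈ xs m∈xs)

splitAtLetter-++ : ∀ {m} L {R} → m ∉ L → splitAtLetter m (L ++ m ∷ R) ≡ (L , R)
splitAtLetter-++ {m} [] m∉L with m ≡ᵇ m | ≡ᵇ-reflects-≡ m m
... | true  | _       = refl
... | false | ofⁿ m≢m = ⊥-elim (m≢m refl)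
splitAtLetter-++ {m} (x ∷ L) m∉L with x ≡ᵇ m | ≡ᵇ-reflects-≡ x m
... | true  | ofʸ refl = ⊥-elim (m∉L (here refl))
... | false | _       = cong (λ (L′ , R′) → x ∷ L′ , R′) (splitAtLetter-++ L (m∉L ∘ there))

decTree′ : ℕ → List ℕ → BinTree
decTree′ zero    _        = leaf
decTree′ (suc f) []       = leaf
decTree′ (suc f) (x ∷ xs) = bin (decTree′ f (proj₁ LR)) (maxL (x ∷ xs)) (decTree′ f (proj₂ LR))
  where LR = splitAtLetter (maxL (x ∷ xs)) (x ∷ xs)

decTree : List ℕ → BinTree
decTree w = decTree′ (length w) w

S′≡postorder∘decTree′ : ∀ f w → S′ f w ≡ postorder (decTree′ f w)
S′≡postorder∘decTree′ zero    w        = refl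
S′≡postorder∘decTree′ (suc f) []       = refl
S′≡postorder∘decTree′ (suc f) (x ∷ xs) =
  cong₂ (λ a b → a ++ b ++ maxL (x ∷ xs) ∷ []) (S′≡postorder∘decTree′ f _) (S′≡postorder∘decTree′ f _)

All<⇒∉ : ∀ {m xs} → All (_< m) xs → m ∉ xs
All<⇒∉ xs<m m∈xs = <-irrefl refl (All.lookup xs<m m∈xs)

maxL-++-∷ : ∀ {m} L R → All (_< m) L → All (_< m) R → maxL (L ++ m ∷ R) ≡ m
maxL-++-∷ L R L<m R<m =
  maxL≡ (∈-++⁺ʳ L (here refl)) (All.++⁺ (All.map <⇒≤ L<m) (≤-refl ∷ All.map <⇒≤ R<m))

decTree′-++-∷ : ∀ f {m} L R → All (_< m) L → All (_< m) R →
  decTree′ (suc f) (L ++ m ∷ R) ≡ bin (decTree′ f L) m (decTree′ f R)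
decTree′-++-∷ f {m} L R L<m R<m = begin
  decTree′ (suc f) w  ≡⟨ unfold L ⟩
  rootAt w (maxL w)   ≡⟨ cong (rootAt w) (maxL-++-∷ L R L<m R<m) ⟩
  rootAt w m          ≡⟨ cong (λ (L′ , R′) → bin (decTree′ f L′) m (decTree′ f R′)) (splitAtLetter-++ L (All<⇒∉ L<m)) ⟩
  bin (decTree′ f L) m (decTree′ f R) ∎
  where
  open ≡-Reasoning
  w = L ++ m ∷ R
  rootAt : List ℕ → ℕ → BinTree
  rootAt v k = bin (decTree′ f (proj₁ (splitAtLetter k v))) k (decTree′ f (proj₂ (splitAtLetter k v)))
  unfold : ∀ L′ → decTree′ (suc f) (L′ ++ m ∷ R) ≡ rootAt (L′ ++ m ∷ R) (maxL (L′ ++ m ∷ R))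
  unfold []      = refl
  unfold (_ ∷ _) = refl

length-++-∷-≤ : ∀ L {m : ℕ} R {f} → length (L ++ m ∷ R) ≤ suc f → length L ≤ f × length R ≤ f
length-++-∷-≤ L R {f} le = suc-+-≤ (length L) (length R) (subst (_≤ suc f) (length-++-∷ L R) le)

inorder-decTree′ : ∀ f w → length w ≤ f → inorder (decTree′ f w) ≡ w
inorder-decTree′ zero    []       _  = refl
inorder-decTree′ (suc f) []       _  = refl
inorder-decTree′ (suc f) (x ∷ xs) le
  with splitAtLetter (maxL (x ∷ xs)) (x ∷ xs) | splitAtLetter-∈ (x ∷ xs) (maxL∈ x xs)
... | L , R | split with length-++-∷-≤ L R (subst (λ w → length w ≤ suc f) (sym split) le)
...   | |L|≤f , |R|≤f =
  trans (cong₂ (λ L′ R′ → L′ ++ maxL (x ∷ xs) ∷ R′) (inorder-decTree′ f L |L|≤f) (inorder-decTree′ f R |R|≤f)) split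

decTree′-inorder : ∀ f t → Decreasing t → size t ≤ f → decTree′ f (inorder t) ≡ t
decTree′-inorder zero    leaf        _                    _  = refl
decTree′-inorder zero    (bin _ _ _) _                    ()
decTree′-inorder (suc f) leaf        _                    _  = refl
decTree′-inorder (suc f) (bin l m r) (l<m , r<m , dl , dr) le =
  trans (decTree′-++-∷ f (inorder l) (inorder r) l<m r<m)
        (cong₂ (λ l′ r′ → bin l′ m r′) (decTree′-inorder f l dl (proj₁ sizes)) (decTree′-inorder f r dr (proj₂ sizes)))
  where sizes = suc-+-≤ (size l) (size r) le

Unique-++-∷ : ∀ L {m : ℕ} {R} → Unique (L ++ m ∷ R) → m ∉ L × m ∉ R × Unique L × Unique R
Unique-++-∷ []      (m≢R ∷ uR) = (λ ()) , All.All¬⇒¬Any m≢R , [] , uR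
Unique-++-∷ (x ∷ L) (x≢ ∷ u) with Unique-++-∷ L u
... | m∉L , m∉R , uL , uR = m∉x∷L , m∉R , All.++⁻ˡ L x≢ ∷ uL , uR
  where
  m∉x∷L : _ ∉ x ∷ L
  m∉x∷L (here m≡x)  = All.lookup x≢ (∈-++⁺ʳ L (here refl)) (sym m≡x)
  m∉x∷L (there m∈L) = m∉L m∈L

≤∧∉⇒< : ∀ {m xs} → All (_≤ m) xs → m ∉ xs → All (_< m) xs
≤∧∉⇒< []           _      = []
≤∧∉⇒< (x≤m ∷ xs≤m) m∉x∷xs = ≤∧≢⇒< x≤m (λ x≡m → m∉x∷xs (here (sym x≡m))) ∷ ≤∧∉⇒< xs≤m (m∉x∷xs ∘ there)

unique-max-split : ∀ L {m} R → All (_≤ m) (L ++ m ∷ R) → Unique (L ++ m ∷ R) →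
  All (_< m) L × All (_< m) R × Unique L × Unique R
unique-max-split L R ≤m u with Unique-++-∷ L u | All.++⁻ʳ L ≤m
... | m∉L , m∉R , uL , uR | _ ∷ R≤m = ≤∧∉⇒< (All.++⁻ˡ L ≤m) m∉L , ≤∧∉⇒< R≤m m∉R , uL , uR

decreasing-decTree′ : ∀ f w → Unique w → length w ≤ f → Decreasing (decTree′ f w)
decreasing-decTree′ zero    []       _ _  = tt
decreasing-decTree′ (suc f) []       _ _  = tt
decreasing-decTree′ (suc f) (x ∷ xs) u le
  with splitAtLetter (maxL (x ∷ xs)) (x ∷ xs) | splitAtLetter-∈ (x ∷ xs) (maxL∈ x xs)
... | L , R | split
  with length-++-∷-≤ L R (subst (λ w → length w ≤ suc f) (sym split) le)
     | unique-max-split L R (subst (All (_≤ maxL (x ∷ xs))) (sym split) (xs≤maxL (x ∷ xs))) (subst Unique (sym split) u)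
...   | |L|≤f , |R|≤f | L<m , R<m , uL , uR =
  subst (All (_< maxL (x ∷ xs))) (sym (inorder-decTree′ f L |L|≤f)) L<m ,
  subst (All (_< maxL (x ∷ xs))) (sym (inorder-decTree′ f R |R|≤f)) R<m ,
  decreasing-decTree′ f L uL |L|≤f ,
  decreasing-decTree′ f R uR |R|≤f

inorder-decTree : ∀ w → inorder (decTree w) ≡ w
inorder-decTree w = inorder-decTree′ (length w) w ≤-refl

decreasing-decTree : ∀ {w} → Unique w → Decreasing (decTree w)
decreasing-decTree {w} u = decreasing-decTree′ (length w) w u ≤-refl

decTree-inorder : ∀ {t} → Decreasing t → decTree (inorder t) ≡ t
decTree-inorder {t} d = decTree′-inorder (length (inorder t)) t d (≤-reflexive (sym (length-inorder t)))

S≡postorder∘decTree : ∀ w → S w ≡ postorder (decTree w)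
S≡postorder∘decTree w = S′≡postorder∘decTree′ (length w) w

-- The involution ι and the bijection φ

branching : BinTree → BinTree → Bool
branching (bin _ _ _) (bin _ _ _) = true
branching _           _           = false

orient : Bool → BinTree → BinTree → BinTree × BinTree
orient true  l r = l , r
orient false l r = r , l

ι : BinTree → BinTree
ι leaf        = leaf
ι (bin l m r) = let l′ , r′ = orient (branching l r) (ι l) (ι r) in bin l′ m r′

φ : BinTree → BinTree
φ leaf        = leaf
φ (bin l m r) = bin (φ l) m (ι (φ r))

-- Inverting φ(l m r) = φ(l) m ι(φ(r)) calls for ψ ∘ ι on the right subtree, so ψι = ψ ∘ ι is
-- defined alongside ψ to keep the recursion structural.
mutual
  ψ : BinTree → BinTree
  ψ leaf        = leaf
  ψ (bin l m r) = bin (ψ l) m (ψι r)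

  ψι : BinTree → BinTree
  ψι leaf        = leaf
  ψι (bin l m r) = if branching l r then bin (ψι l) m (ψ r) else bin (ψι r) m (ψ l)

branching-ι : ∀ l r → branching (ι l) (ι r) ≡ branching l r
branching-ι leaf        _           = refl
branching-ι (bin _ _ _) leaf        = refl
branching-ι (bin _ _ _) (bin _ _ _) = refl

branching-comm : ∀ l r → branching l r ≡ branching r l
branching-comm leaf        leaf        = refl
branching-comm leaf        (bin _ _ _) = refl
branching-comm (bin _ _ _) leaf        = refl
branching-comm (bin _ _ _) (bin _ _ _) = refl

ι-involutive : ∀ t → ι (ι t) ≡ t
ι-involutive leaf = refl
ι-involutive (bin l m r) with branching l r in eq
... | true  rewrite branching-ι l r | eq = cong₂ (λ l′ r′ → bin l′ m r′) (ι-involutive l) (ι-involutive r)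
... | false rewrite branching-ι r l | branching-comm r l | eq = cong₂ (λ l′ r′ → bin l′ m r′) (ι-involutive l) (ι-involutive r)

postorder-ι : ∀ t → postorder (ι t) ≡ postorder t
postorder-ι leaf                          = refl
postorder-ι (bin leaf m r)                = cong (_++ m ∷ []) (postorder-ι r)
postorder-ι (bin l@(bin _ _ _) m leaf)    = cong (_++ m ∷ []) (postorder-ι l)
postorder-ι (bin l@(bin _ _ _) m r@(bin _ _ _)) =
  cong₂ (λ a b → a ++ b ++ m ∷ []) (postorder-ι l) (postorder-ι r)

↭-++-∷ : ∀ {A A′ B B′ : List ℕ} m → A ↭ A′ → B ↭ B′ → A ++ m ∷ B ↭ A′ ++ m ∷ B′
↭-++-∷ m A↭A′ B↭B′ = ↭.++⁺ A↭A′ (prep m B↭B′)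

↭-swap-around : ∀ (A : List ℕ) m B → A ++ m ∷ B ↭ B ++ m ∷ A
↭-swap-around A m B = ↭-trans (↭.++-comm A (m ∷ B)) (↭-sym (↭.shift m B A))

All-resp-↭˘ : ∀ {P : ℕ → Set} {xs ys} → xs ↭ ys → All P ys → All P xs
All-resp-↭˘ xs↭ys = ↭.All-resp-↭ (↭-sym xs↭ys)

inorder-ι : ∀ t → inorder (ι t) ↭ inorder t
inorder-ι leaf = ↭-refl
inorder-ι (bin l m r) with branching l r
... | true  = ↭-++-∷ m (inorder-ι l) (inorder-ι r)
... | false = ↭-trans (↭-swap-around (inorder (ι r)) m (inorder (ι l))) (↭-++-∷ m (inorder-ι l) (inorder-ι r))

decreasing-ι : ∀ t → Decreasing t → Decreasing (ι t)
decreasing-ι leaf        _                    = tt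
decreasing-ι (bin l m r) (l<m , r<m , dl , dr) with branching l r
... | true  = All-resp-↭˘ (inorder-ι l) l<m , All-resp-↭˘ (inorder-ι r) r<m ,
              decreasing-ι l dl , decreasing-ι r dr
... | false = All-resp-↭˘ (inorder-ι r) r<m , All-resp-↭˘ (inorder-ι l) l<m ,
              decreasing-ι r dr , decreasing-ι l dl

postorder-φ : ∀ t → postorder (φ t) ≡ postorder t
postorder-φ leaf        = refl
postorder-φ (bin l m r) =
  cong₂ (λ a b → a ++ b ++ m ∷ []) (postorder-φ l) (trans (postorder-ι (φ r)) (postorder-φ r))

inorder-φ : ∀ t → inorder (φ t) ↭ inorder t
inorder-φ leaf        = ↭-refl
inorder-φ (bin l m r) = ↭-++-∷ m (inorder-φ l) (↭-trans (inorder-ι (φ r)) (inorder-φ r))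

decreasing-φ : ∀ t → Decreasing t → Decreasing (φ t)
decreasing-φ leaf        _                    = tt
decreasing-φ (bin l m r) (l<m , r<m , dl , dr) =
  All-resp-↭˘ (inorder-φ l) l<m ,
  All-resp-↭˘ (↭-trans (inorder-ι (φ r)) (inorder-φ r)) r<m ,
  decreasing-φ l dl ,
  decreasing-ι (φ r) (decreasing-φ r dr)

mutual
  inorder-ψ : ∀ t → inorder (ψ t) ↭ inorder t
  inorder-ψ leaf        = ↭-refl
  inorder-ψ (bin l m r) = ↭-++-∷ m (inorder-ψ l) (inorder-ψι r)

  inorder-ψι : ∀ t → inorder (ψι t) ↭ inorder t
  inorder-ψι leaf = ↭-refl
  inorder-ψι (bin l m r) with branching l r
  ... | true  = ↭-++-∷ m (inorder-ψι l) (inorder-ψ r)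
  ... | false = ↭-trans (↭-swap-around (inorder (ψι r)) m (inorder (ψ l))) (↭-++-∷ m (inorder-ψ l) (inorder-ψι r))

mutual
  decreasing-ψ : ∀ t → Decreasing t → Decreasing (ψ t)
  decreasing-ψ leaf        _                    = tt
  decreasing-ψ (bin l m r) (l<m , r<m , dl , dr) =
    All-resp-↭˘ (inorder-ψ l) l<m , All-resp-↭˘ (inorder-ψι r) r<m ,
    decreasing-ψ l dl , decreasing-ψι r dr

  decreasing-ψι : ∀ t → Decreasing t → Decreasing (ψι t)
  decreasing-ψι leaf        _                    = tt
  decreasing-ψι (bin l m r) (l<m , r<m , dl , dr) with branching l r
  ... | true  = All-resp-↭˘ (inorder-ψι l) l<m , All-resp-↭˘ (inorder-ψ r) r<m ,
                decreasing-ψι l dl , decreasing-ψ r dr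
  ... | false = All-resp-↭˘ (inorder-ψι r) r<m , All-resp-↭˘ (inorder-ψ l) l<m ,
                decreasing-ψι r dr , decreasing-ψ l dl

mutual
  ψι∘ι≗ψ : ∀ t → ψι (ι t) ≡ ψ t
  ψι∘ι≗ψ leaf = refl
  ψι∘ι≗ψ (bin l m r) with branching l r in eq
  ... | true  rewrite branching-ι l r | eq = cong₂ (λ l′ r′ → bin l′ m r′) (ψι∘ι≗ψ l) (ψ∘ι≗ψι r)
  ... | false rewrite branching-ι r l | branching-comm r l | eq = cong₂ (λ l′ r′ → bin l′ m r′) (ψι∘ι≗ψ l) (ψ∘ι≗ψι r)

  ψ∘ι≗ψι : ∀ t → ψ (ι t) ≡ ψι t
  ψ∘ι≗ψι leaf = refl
  ψ∘ι≗ψι (bin l m r) with branching l r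
  ... | true  = cong₂ (λ l′ r′ → bin l′ m r′) (ψ∘ι≗ψι l) (ψι∘ι≗ψ r)
  ... | false = cong₂ (λ l′ r′ → bin l′ m r′) (ψ∘ι≗ψι r) (ψι∘ι≗ψ l)

ψ∘φ≗id : ∀ t → ψ (φ t) ≡ t
ψ∘φ≗id leaf        = refl
ψ∘φ≗id (bin l m r) = cong₂ (λ l′ r′ → bin l′ m r′) (ψ∘φ≗id l) (trans (ψι∘ι≗ψ (φ r)) (ψ∘φ≗id r))

mutual
  φ∘ψ≗id : ∀ t → φ (ψ t) ≡ t
  φ∘ψ≗id leaf        = refl
  φ∘ψ≗id (bin l m r) = cong₂ (λ l′ r′ → bin l′ m r′) (φ∘ψ≗id l) (trans (cong ι (φ∘ψι≗ι r)) (ι-involutive r))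

  φ∘ψι≗ι : ∀ t → φ (ψι t) ≡ ι t
  φ∘ψι≗ι leaf = refl
  φ∘ψι≗ι (bin l m r) with branching l r
  ... | true  = cong₂ (λ l′ r′ → bin l′ m r′) (φ∘ψι≗ι l) (cong ι (φ∘ψ≗id r))
  ... | false = cong₂ (λ l′ r′ → bin l′ m r′) (φ∘ψι≗ι r) (cong ι (φ∘ψ≗id l))

-- des and veh on trees

hasRoot : BinTree → ℕ
hasRoot leaf        = 0
hasRoot (bin _ _ _) = 1

leftEdges : BinTree → ℕ
leftEdges leaf        = 0
leftEdges (bin l m r) = leftEdges l + (hasRoot l + leftEdges r)

rightEdges : BinTree → ℕ
rightEdges leaf        = 0
rightEdges (bin l m r) = rightEdges l + (hasRoot r + rightEdges r)

hasRoot+edges≡size : ∀ t → hasRoot t + leftEdges t + rightEdges t ≡ size t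
hasRoot+edges≡size leaf        = refl
hasRoot+edges≡size (bin l m r) =
  cong suc (trans (regroup (leftEdges l) (hasRoot l) (leftEdges r) (rightEdges l) (hasRoot r) (rightEdges r))
                  (cong₂ _+_ (hasRoot+edges≡size l) (hasRoot+edges≡size r)))
  where
  regroup : ∀ a b c d e f → a + (b + c) + (d + (e + f)) ≡ (b + a + d) + (e + c + f)
  regroup = solve-∀

hasRoot-ι : ∀ t → hasRoot (ι t) ≡ hasRoot t
hasRoot-ι leaf        = refl
hasRoot-ι (bin _ _ _) = refl

rightEdges-ι : ∀ t → rightEdges (ι t) ≡ leftEdges t
rightEdges-ι leaf                                = refl
rightEdges-ι (bin leaf m leaf)                   = refl
rightEdges-ι (bin leaf m r@(bin _ _ _))          = trans (+-identityʳ _) (rightEdges-ι r)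
rightEdges-ι (bin l@(bin _ _ _) m leaf)          = trans (cong suc (rightEdges-ι l)) (+-comm 1 (leftEdges l))
rightEdges-ι (bin l@(bin _ _ _) m r@(bin _ _ _)) =
  cong₂ (λ a b → a + suc b) (rightEdges-ι l) (rightEdges-ι r)

isPositiveEven : ℕ → ℕ
isPositiveEven d = if even d ∧ not (d ≡ᵇ 0) then 1 else 0

-- In T(inorder t; m) a right child of t lies one level below its parent and a left child on
-- the same level; evenDepths d t counts the vertices at even positive depth when the left
-- spine of t is at depth d.
evenDepths : ℕ → BinTree → ℕ
evenDepths d leaf        = 0
evenDepths d (bin l m r) = evenDepths d l + (isPositiveEven d + evenDepths (suc d) r)

isPositiveEven-suc+suc : ∀ d → isPositiveEven (suc d) + isPositiveEven (suc (suc d)) ≡ 1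
isPositiveEven-suc+suc d with even d
... | true  = refl
... | false = refl

evenDepths-suc+suc : ∀ d t → evenDepths (suc d) t + evenDepths (suc (suc d)) t ≡ size t
evenDepths-suc+suc d leaf        = refl
evenDepths-suc+suc d (bin l m r) =
  trans (regroup (evenDepths (suc d) l) (isPositiveEven (suc d)) (evenDepths (suc (suc d)) r)
                 (evenDepths (suc (suc d)) l) (isPositiveEven (suc (suc d))) (evenDepths (suc (suc (suc d))) r))
        (cong₂ _+_ (isPositiveEven-suc+suc d) (cong₂ _+_ (evenDepths-suc+suc d l) (evenDepths-suc+suc (suc d) r)))
  where
  regroup : ∀ a b c d e f → a + (b + c) + (d + (e + f)) ≡ (b + e) + ((a + d) + (c + f))
  regroup = solve-∀

size-φ : ∀ t → size (φ t) ≡ size t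
size-φ t = trans (sym (length-inorder (φ t))) (trans (↭.↭-length (inorder-φ t)) (length-inorder t))

rightEdges-φ : ∀ t → rightEdges (φ t) ≡ evenDepths 1 t
rightEdges-φ leaf        = refl
rightEdges-φ (bin l m r) = cong₂ _+_ (rightEdges-φ l) right
  where
  open ≡-Reasoning
  s = φ r
  right : hasRoot (ι s) + rightEdges (ι s) ≡ evenDepths 2 r
  right = +-cancelʳ-≡ (evenDepths 1 r) _ _ (begin
    hasRoot (ι s) + rightEdges (ι s) + evenDepths 1 r
      ≡⟨ cong₂ (λ a b → a + b + evenDepths 1 r) (hasRoot-ι s) (rightEdges-ι s) ⟩
    hasRoot s + leftEdges s + evenDepths 1 r
      ≡⟨ cong (hasRoot s + leftEdges s +_) (sym (rightEdges-φ r)) ⟩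
    hasRoot s + leftEdges s + rightEdges s  ≡⟨ hasRoot+edges≡size s ⟩
    size s                                  ≡⟨ size-φ r ⟩
    size r                                  ≡⟨ sym (evenDepths-suc+suc 0 r) ⟩
    evenDepths 1 r + evenDepths 2 r         ≡⟨ +-comm (evenDepths 1 r) (evenDepths 2 r) ⟩
    evenDepths 2 r + evenDepths 1 r         ∎)

<ᵇ-false : ∀ {x y} → x < y → (y <ᵇ x) ≡ false
<ᵇ-false {x} {y} x<y with y <ᵇ x | <ᵇ-reflects-< y x
... | false | _       = refl
... | true  | ofʸ y<x = ⊥-elim (<-asym x<y y<x)

<ᵇ-true : ∀ {x y} → x < y → (x <ᵇ y) ≡ true
<ᵇ-true {x} {y} x<y with x <ᵇ y | <ᵇ-reflects-< x y
... | true  | _        = refl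
... | false | ofⁿ x≮y = ⊥-elim (x≮y x<y)

des-++-∷ : ∀ xs {y} ys → All (_< y) xs → des (xs ++ y ∷ ys) ≡ des xs + des (y ∷ ys)
des-++-∷ []            ys _          = refl
des-++-∷ (x ∷ [])      ys (x<y ∷ []) rewrite <ᵇ-false x<y = refl
des-++-∷ (x ∷ x′ ∷ xs) ys (_ ∷ xs<y) =
  trans (cong ((if x′ <ᵇ x then 1 else 0) +_) (des-++-∷ (x′ ∷ xs) ys xs<y))
        (sym (+-assoc (if x′ <ᵇ x then 1 else 0) (des (x′ ∷ xs)) _))

des-∷-< : ∀ {m y} ys → y < m → des (m ∷ y ∷ ys) ≡ suc (des (y ∷ ys))
des-∷-< ys y<m rewrite <ᵇ-true y<m = refl

des-∷-inorder : ∀ {m} t → All (_< m) (inorder t) → des (m ∷ inorder t) ≡ hasRoot t + des (inorder t)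
des-∷-inorder leaf        _ = refl
des-∷-inorder (bin l x r) t<m with inorder l | t<m
... | []    | x<m ∷ _ = des-∷-< (inorder r) x<m
... | y ∷ w | y<m ∷ _ = des-∷-< (w ++ x ∷ inorder r) y<m

des-inorder : ∀ t → Decreasing t → des (inorder t) ≡ rightEdges t
des-inorder leaf        _                    = refl
des-inorder (bin l m r) (l<m , r<m , dl , dr) = begin
  des (inorder l ++ m ∷ inorder r)          ≡⟨ des-++-∷ (inorder l) (inorder r) l<m ⟩
  des (inorder l) + des (m ∷ inorder r)     ≡⟨ cong (des (inorder l) +_) (des-∷-inorder r r<m) ⟩
  des (inorder l) + (hasRoot r + des (inorder r))
    ≡⟨ cong₂ (λ a b → a + (hasRoot r + b)) (des-inorder l dl) (des-inorder r dr) ⟩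
  rightEdges (bin l m r)                    ∎
  where open ≡-Reasoning

module _ {A : Set} {P : A → Set} (P? : Decidable P) where

  takeWhile-++-∷ : ∀ xs {y ys} → ¬ P y → takeWhile P? (xs ++ y ∷ ys) ≡ takeWhile P? xs
  takeWhile-++-∷ []       {y} ¬py with P? y
  ... | yes py = ⊥-elim (¬py py)
  ... | no _   = refl
  takeWhile-++-∷ (x ∷ xs) ¬py with P? x
  ... | yes _ = cong (x ∷_) (takeWhile-++-∷ xs ¬py)
  ... | no _  = refl

  dropWhile-++-∷ : ∀ xs {y ys} → ¬ P y → dropWhile P? (xs ++ y ∷ ys) ≡ dropWhile P? xs ++ y ∷ ys
  dropWhile-++-∷ []       {y} ¬py with P? y
  ... | yes py = ⊥-elim (¬py py)
  ... | no _   = refl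
  dropWhile-++-∷ (x ∷ xs) ¬py with P? x
  ... | yes _ = dropWhile-++-∷ xs ¬py
  ... | no _  = refl

  length-dropWhile : ∀ xs → length (dropWhile P? xs) ≤ length xs
  length-dropWhile xs = begin
    length (dropWhile P? xs)                              ≤⟨ m≤n+m _ _ ⟩
    length (takeWhile P? xs) + length (dropWhile P? xs)   ≡⟨ length-++ (takeWhile P? xs) ⟨
    length (takeWhile P? xs ++ dropWhile P? xs)           ≡⟨ cong length (takeWhile++dropWhile P? xs) ⟩
    length xs                                             ∎
    where open ≤-Reasoning

blocks′-[] : ∀ g → blocks′ g [] ≡ []
blocks′-[] zero    = refl
blocks′-[] (suc g) = refl

blocks′-++-∷ : ∀ g L {m} R → All (_< m) L → All (_< m) R → length L < g →
  blocks′ g (L ++ m ∷ R) ≡ blocks′ g L ++ (m , R) ∷ []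
blocks′-++-∷ (suc g) [] {m} R _ R<m _ =
  trans (cong₂ (λ w v → (m , w) ∷ blocks′ g v) (All.all⇒takeWhile≗id (_<? m) R<m) (All.all⇒dropWhile≡[] (_<? m) R<m))
        (cong ((m , R) ∷_) (blocks′-[] g))
blocks′-++-∷ (suc g) (x ∷ L) {m} R (x<m ∷ L<m) R<m (s≤s |L|<g) =
  trans (cong₂ (λ w v → (x , w) ∷ blocks′ g v) (takeWhile-++-∷ (_<? x) L m≮x) (dropWhile-++-∷ (_<? x) L m≮x))
        (cong ((x , takeWhile (_<? x) L) ∷_)
              (blocks′-++-∷ g (dropWhile (_<? x) L) R (All.dropWhile⁺ (_<? x) L<m) R<m
                            (≤-<-trans (length-dropWhile (_<? x) L) |L|<g)))
  where m≮x = <⇒≯ x<m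

spineBlocks : BinTree → List (ℕ × List ℕ)
spineBlocks leaf        = []
spineBlocks (bin l m r) = spineBlocks l ++ (m , inorder r) ∷ []

blocks′-inorder : ∀ g t → Decreasing t → size t ≤ g → blocks′ g (inorder t) ≡ spineBlocks t
blocks′-inorder g leaf        _                    _  = blocks′-[] g
blocks′-inorder g (bin l m r) (l<m , r<m , dl , _) le =
  trans (blocks′-++-∷ g (inorder l) (inorder r) l<m r<m (subst (_< g) (sym (length-inorder l)) |l|<g))
        (cong (_++ (m , inorder r) ∷ []) (blocks′-inorder g l dl (<⇒≤ |l|<g)))
  where
  |l|<g : size l < g
  |l|<g = ≤-trans (s≤s (m≤m+n (size l) (size r))) le

forest : BinTree → List Tree
forest leaf        = []
forest (bin l m r) = forest l ++ node (fin m) (forest r) ∷ []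

map-spineBlocks : ∀ {f} (h : ℕ × List ℕ → Tree) →
  (∀ m r → Decreasing r → size r ≤ f → h (m , inorder r) ≡ node (fin m) (forest r)) →
  ∀ t → Decreasing t → size t ≤ suc f → map h (spineBlocks t) ≡ forest t
map-spineBlocks h h-spec leaf        _                  _  = refl
map-spineBlocks h h-spec (bin l m r) (_ , _ , dl , dr) le =
  trans (map-++ h (spineBlocks l) ((m , inorder r) ∷ []))
        (cong₂ (λ ts t → ts ++ t ∷ []) (map-spineBlocks h h-spec l dl (m≤n⇒m≤1+n |l|≤f)) (h-spec m r dr |r|≤f))
  where
  |l|≤f = proj₁ (suc-+-≤ (size l) (size r) le)
  |r|≤f = proj₂ (suc-+-≤ (size l) (size r) le)

T′-inorder : ∀ f t lab → Decreasing t → size t ≤ f → T′ f (inorder t) lab ≡ node lab (forest t)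
T′-inorder zero    leaf        lab _ _  = refl
T′-inorder zero    (bin _ _ _) lab _ ()
T′-inorder (suc f) t    lab d le =
  cong (node lab)
    (trans (cong (map _) (blocks′-inorder (length (inorder t)) t d (≤-reflexive (sym (length-inorder t)))))
           (map-spineBlocks _ (λ m r dr |r|≤f → T′-inorder f r (fin m) dr |r|≤f) t d le))

evenNonRootF-++ : ∀ d ts us → evenNonRootF d (ts ++ us) ≡ evenNonRootF d ts + evenNonRootF d us
evenNonRootF-++ d []       us = refl
evenNonRootF-++ d (t ∷ ts) us =
  trans (cong (evenNonRoot d t +_) (evenNonRootF-++ d ts us)) (sym (+-assoc (evenNonRoot d t) _ _))

evenNonRootF-forest : ∀ d t → evenNonRootF d (forest t) ≡ evenDepths d t
evenNonRootF-forest d leaf        = refl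
evenNonRootF-forest d (bin l m r) =
  trans (evenNonRootF-++ d (forest l) (node (fin m) (forest r) ∷ []))
        (cong₂ _+_ (evenNonRootF-forest d l)
                   (trans (+-identityʳ _) (cong (isPositiveEven d +_) (evenNonRootF-forest (suc d) r))))

veh-inorder : ∀ t → Decreasing t → veh (inorder t) ≡ evenDepths 1 t
veh-inorder t d =
  trans (cong (evenNonRoot 0) (T′-inorder (length (inorder t)) t ∞ d (≤-reflexive (sym (length-inorder t)))))
        (evenNonRootF-forest 1 t)

-- The bijection on words

Φ : List ℕ → List ℕ
Φ π = inorder (φ (decTree π))

Ψ : List ℕ → List ℕ
Ψ π = inorder (ψ (decTree π))

Φ-↭ : ∀ π → Φ π ↭ π
Φ-↭ π = ↭-trans (inorder-φ (decTree π)) (↭-reflexive (inorder-decTree π))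

Ψ-↭ : ∀ π → Ψ π ↭ π
Ψ-↭ π = ↭-trans (inorder-ψ (decTree π)) (↭-reflexive (inorder-decTree π))

decTree-Φ : ∀ {π} → Unique π → decTree (Φ π) ≡ φ (decTree π)
decTree-Φ u = decTree-inorder (decreasing-φ _ (decreasing-decTree u))

decTree-Ψ : ∀ {π} → Unique π → decTree (Ψ π) ≡ ψ (decTree π)
decTree-Ψ u = decTree-inorder (decreasing-ψ _ (decreasing-decTree u))

Ψ∘Φ : ∀ {π} → Unique π → Ψ (Φ π) ≡ π
Ψ∘Φ {π} u = trans (cong (inorder ∘ ψ) (decTree-Φ u)) (trans (cong inorder (ψ∘φ≗id (decTree π))) (inorder-decTree π))

Φ∘Ψ : ∀ {π} → Unique π → Φ (Ψ π) ≡ π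
Φ∘Ψ {π} u = trans (cong (inorder ∘ φ) (decTree-Ψ u)) (trans (cong inorder (φ∘ψ≗id (decTree π))) (inorder-decTree π))

S∘Φ : ∀ {π} → Unique π → S (Φ π) ≡ S π
S∘Φ {π} u = begin
  S (Φ π)                       ≡⟨ S≡postorder∘decTree (Φ π) ⟩
  postorder (decTree (Φ π))     ≡⟨ cong postorder (decTree-Φ u) ⟩
  postorder (φ (decTree π))     ≡⟨ postorder-φ (decTree π) ⟩
  postorder (decTree π)         ≡⟨ S≡postorder∘decTree π ⟨
  S π                           ∎
  where open ≡-Reasoning

des∘Φ : ∀ {π} → Unique π → des (Φ π) ≡ veh π
des∘Φ {π} u = begin
  des (inorder (φ t))  ≡⟨ des-inorder (φ t) (decreasing-φ t d) ⟩
  rightEdges (φ t)     ≡⟨ rightEdges-φ t ⟩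
  evenDepths 1 t       ≡⟨ veh-inorder t d ⟨
  veh (inorder t)      ≡⟨ cong veh (inorder-decTree π) ⟩
  veh π                ∎
  where
  open ≡-Reasoning
  t = decTree π
  d = decreasing-decTree u

-- Permutations and counting

Unique-resp-↭ : ∀ {xs ys : List ℕ} → xs ↭ ys → Unique xs → Unique ys
Unique-resp-↭ xs↭ys = Unique-resp-↭ₛ (↭⇒↭ₛ xs↭ys)

idPerm-< : ∀ n → All (_< suc n) (idPerm n)
idPerm-< zero    = []
idPerm-< (suc n) = All.++⁺ (All.map m<n⇒m<1+n (idPerm-< n)) (≤-refl ∷ [])

idPerm-unique : ∀ n → Unique (idPerm n)
idPerm-unique zero    = []
idPerm-unique (suc n) =
  Unique.++⁺ (idPerm-unique n) ([] ∷ []) λ { (m∈ , here refl) → All<⇒∉ (idPerm-< n) m∈ }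

increasingTree : ℕ → BinTree
increasingTree zero    = leaf
increasingTree (suc n) = bin (increasingTree n) (suc n) leaf

inorder-increasingTree : ∀ n → inorder (increasingTree n) ≡ idPerm n
inorder-increasingTree zero    = refl
inorder-increasingTree (suc n) = cong (_++ suc n ∷ []) (inorder-increasingTree n)

decreasing-increasingTree : ∀ n → Decreasing (increasingTree n)
decreasing-increasingTree zero    = tt
decreasing-increasingTree (suc n) =
  subst (All (_< suc n)) (sym (inorder-increasingTree n)) (idPerm-< n) , [] , decreasing-increasingTree n , tt

φ-increasingTree : ∀ n → φ (increasingTree n) ≡ increasingTree n
φ-increasingTree zero    = refl
φ-increasingTree (suc n) = cong (λ t → bin t (suc n) leaf) (φ-increasingTree n)

Φ-idPerm : ∀ n → Φ (idPerm n) ≡ idPerm n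
Φ-idPerm n = begin
  Φ (idPerm n)                        ≡⟨ cong Φ (inorder-increasingTree n) ⟨
  Φ (inorder (increasingTree n))      ≡⟨ cong (inorder ∘ φ) (decTree-inorder (decreasing-increasingTree n)) ⟩
  inorder (φ (increasingTree n))      ≡⟨ cong inorder (φ-increasingTree n) ⟩
  inorder (increasingTree n)          ≡⟨ inorder-increasingTree n ⟩
  idPerm n                            ∎
  where open ≡-Reasoning

insertions-↭ : ∀ x σ {π} → π ∈ insertions x σ → π ↭ x ∷ σ
insertions-↭ x []       (here refl) = ↭-refl
insertions-↭ x (y ∷ ys) (here refl) = ↭-refl
insertions-↭ x (y ∷ ys) (there π∈)  with ∈-map⁻ (y ∷_) π∈
... | π′ , π′∈ , refl = ↭-trans (prep y (insertions-↭ x ys π′∈)) (swap y x ↭-refl)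

∈-insertions : ∀ x A B → A ++ x ∷ B ∈ insertions x (A ++ B)
∈-insertions x []      []      = here refl
∈-insertions x []      (_ ∷ _) = here refl
∈-insertions x (a ∷ A) B       = there (∈-map⁺ (a ∷_) (∈-insertions x A B))

∈-perms⇒↭ : ∀ n {π} → π ∈ perms n → π ↭ idPerm n
∈-perms⇒↭ zero    (here refl) = ↭-refl
∈-perms⇒↭ (suc n) π∈ with find (∈-concatMap⁻ (insertions (suc n)) {xs = perms n} π∈)
... | σ , σ∈ , π∈ins =
  ↭-trans (insertions-↭ (suc n) σ π∈ins) (↭-trans (prep (suc n) (∈-perms⇒↭ n σ∈)) (↭.∷↭∷ʳ (suc n) (idPerm n)))

↭⇒∈-perms : ∀ n {π} → π ↭ idPerm n → π ∈ perms n
↭⇒∈-perms zero    π↭[] rewrite ↭.↭-empty-inv π↭[] = here refl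
↭⇒∈-perms (suc n) π↭ with ∈-∃++ (↭.∈-resp-↭ (↭-sym π↭) (∈-++⁺ʳ (idPerm n) (here refl)))
... | A , B , refl = ∈-concatMap⁺ (insertions (suc n)) {xs = perms n} (lose (↭⇒∈-perms n A++B↭) (∈-insertions (suc n) A B))
  where
  A++B↭ : A ++ B ↭ idPerm n
  A++B↭ = ↭-trans (↭.drop-mid A (idPerm n) π↭) (↭-reflexive (++-identityʳ (idPerm n)))

∈-perms⇒Unique : ∀ n {π} → π ∈ perms n → Unique π
∈-perms⇒Unique n π∈ = Unique-resp-↭ (↭-sym (∈-perms⇒↭ n π∈)) (idPerm-unique n)

remove : ℕ → List ℕ → List ℕ
remove x = filter (λ y → ¬? (x ≟ y))

remove-insertions : ∀ x σ {π} → x ∉ σ → π ∈ insertions x σ → remove x π ≡ σ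
remove-insertions x []       _   (here refl) = filter-reject (λ y → ¬? (x ≟ y)) (λ x≢x → x≢x refl)
remove-insertions x (y ∷ ys) x∉σ (here refl) =
  trans (filter-reject (λ y → ¬? (x ≟ y)) (λ x≢x → x≢x refl)) (filter-all (λ y → ¬? (x ≟ y)) (All.¬Any⇒All¬ (y ∷ ys) x∉σ))
remove-insertions x (y ∷ ys) x∉σ (there π∈) with ∈-map⁻ (y ∷_) π∈
... | π′ , π′∈ , refl =
  trans (filter-accept (λ y → ¬? (x ≟ y)) (x∉σ ∘ here)) (cong (y ∷_) (remove-insertions x ys (x∉σ ∘ there) π′∈))

insertions-unique : ∀ x σ → x ∉ σ → Unique (insertions x σ)
insertions-unique x []       _   = [] ∷ []
insertions-unique x (y ∷ ys) x∉σ =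
  All.map⁺ (All.tabulate (λ _ x∷σ≡y∷π′ → x∉σ (here (∷-injectiveˡ x∷σ≡y∷π′))))
  ∷ Unique.map⁺ ∷-injectiveʳ (insertions-unique x ys (x∉σ ∘ there))

concatMap-unique : ∀ {A B : Set} (f : A → List B) (g : B → A) {xs} → Unique xs →
  (∀ {x} → x ∈ xs → Unique (f x)) → (∀ {x y} → x ∈ xs → y ∈ f x → g y ≡ x) → Unique (concatMap f xs)
concatMap-unique f g {[]}     []           _  _         = []
concatMap-unique f g {x ∷ xs} (x∉xs ∷ uxs) uf g-retract =
  Unique.++⁺ (uf (here refl)) (concatMap-unique f g uxs (uf ∘ there) (g-retract ∘ there)) disjoint
  where
  disjoint : ∀ {v} → ¬ (v ∈ f x × v ∈ concatMap f xs)
  disjoint (v∈fx , v∈rest) with find (∈-concatMap⁻ f {xs = xs} v∈rest)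
  ... | z , z∈xs , v∈fz = All.lookup x∉xs z∈xs (trans (sym (g-retract (here refl) v∈fx)) (g-retract (there z∈xs) v∈fz))

perms-unique : ∀ n → Unique (perms n)
perms-unique zero    = [] ∷ []
perms-unique (suc n) =
  concatMap-unique (insertions (suc n)) (remove (suc n)) (perms-unique n)
    (λ σ∈ → insertions-unique (suc n) _ (suc-n∉ σ∈)) (λ σ∈ π∈ → remove-insertions (suc n) _ (suc-n∉ σ∈) π∈)
  where
  suc-n∉ : ∀ {σ} → σ ∈ perms n → suc n ∉ σ
  suc-n∉ σ∈ = All<⇒∉ (All-resp-↭˘ (∈-perms⇒↭ n σ∈) (idPerm-< n))

map-↭ : ∀ {A : Set} {f g : A → A} {xs} → Unique xs →
  (∀ {x} → x ∈ xs → f x ∈ xs) → (∀ {x} → x ∈ xs → g x ∈ xs) →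
  (∀ {x} → x ∈ xs → g (f x) ≡ x) → (∀ {x} → x ∈ xs → f (g x) ≡ x) → map f xs ↭ xs
map-↭ {f = f} {g} {xs} uxs f∈ g∈ g∘f f∘g = ∼bag⇒↭ (unique∧set⇒bag unique-map uxs (mk⇔ to from))
  where
  unique-map : Unique (map f xs)
  unique-map = Unique.map⁻ {f = g} (subst Unique (sym map-g-map-f) uxs)
    where
    map-g-map-f : map g (map f xs) ≡ xs
    map-g-map-f = trans (sym (map-∘ {g = g} {f = f} xs)) (map-id-local (All.tabulate g∘f))
  to : ∀ {z} → z ∈ map f xs → z ∈ xs
  to z∈ with ∈-map⁻ f z∈
  ... | x , x∈ , refl = f∈ x∈
  from : ∀ {z} → z ∈ xs → z ∈ map f xs
  from z∈ = subst (_∈ map f xs) (f∘g z∈) (∈-map⁺ f (g∈ z∈))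

countStat-↭ : ∀ st {k xs ys} → xs ↭ ys → countStat st k xs ≡ countStat st k ys
countStat-↭ st xs↭ys = ↭.↭-length (↭.filter-↭ _ xs↭ys)

countStat-map : ∀ st st′ (f : List ℕ → List ℕ) {k} xs →
  (∀ {x} → x ∈ xs → st (f x) ≡ st′ x) → countStat st k (map f xs) ≡ countStat st′ k xs
countStat-map st st′ f     []       _     = refl
countStat-map st st′ f {k} (x ∷ xs) st∘f≗st′ rewrite st∘f≗st′ (here refl) with does (st′ x ≟ k)
... | true  = cong suc (countStat-map st st′ f xs (st∘f≗st′ ∘ there))
... | false = countStat-map st st′ f xs (st∘f≗st′ ∘ there)

isSorted?≡true⇔ : ∀ n w → isSorted? n w ≡ true ⇔ w ≡ idPerm n
isSorted?≡true⇔ n w = mk⇔ (toWitness ∘ Equivalence.from T-≡) (Equivalence.to T-≡ ∘ fromWitness)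

∈-Snr⁻ : ∀ n r {π} → π ∈ Snr n r → π ∈ perms n × iterate r S π ≡ idPerm n
∈-Snr⁻ n r π∈ with ∈-filter⁻ _ {xs = perms n} π∈
... | π∈perms , sorted = π∈perms , Equivalence.to (isSorted?≡true⇔ n _) sorted

∈-Snr⁺ : ∀ n r {π} → π ∈ perms n → iterate r S π ≡ idPerm n → π ∈ Snr n r
∈-Snr⁺ n r π∈perms sorted = ∈-filter⁺ _ π∈perms (Equivalence.from (isSorted?≡true⇔ n _) sorted)

iterate-suc : ∀ r (g : List ℕ → List ℕ) w → iterate (suc r) g w ≡ iterate r g (g w)
iterate-suc zero    g w = refl
iterate-suc (suc r) g w = cong g (iterate-suc r g w)

Ψ-idPerm : ∀ n → Ψ (idPerm n) ≡ idPerm n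
Ψ-idPerm n = trans (cong Ψ (sym (Φ-idPerm n))) (Ψ∘Φ (idPerm-unique n))

Φ-sorted⇔sorted : ∀ n r {π} → Unique π → iterate r S (Φ π) ≡ idPerm n ⇔ iterate r S π ≡ idPerm n
Φ-sorted⇔sorted n zero    {π} u =
  mk⇔ (λ Φπ≡id → trans (sym (Ψ∘Φ u)) (trans (cong Ψ Φπ≡id) (Ψ-idPerm n))) (λ π≡id → trans (cong Φ π≡id) (Φ-idPerm n))
Φ-sorted⇔sorted n (suc r) {π} u = mk⇔ (trans (sym same)) (trans same)
  where
  same : iterate (suc r) S (Φ π) ≡ iterate (suc r) S π
  same = trans (iterate-suc r S (Φ π)) (trans (cong (iterate r S) (S∘Φ u)) (sym (iterate-suc r S π)))

∈-Snr⇒Unique : ∀ n r {π} → π ∈ Snr n r → Unique π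
∈-Snr⇒Unique n r = ∈-perms⇒Unique n ∘ proj₁ ∘ ∈-Snr⁻ n r

map-Φ-Snr : ∀ n r → map Φ (Snr n r) ↭ Snr n r
map-Φ-Snr n r = map-↭ (Unique.filter⁺ _ (perms-unique n)) Φ∈ Ψ∈ (Ψ∘Φ ∘ unique) (Φ∘Ψ ∘ unique)
  where
  unique = ∈-Snr⇒Unique n r
  Φ∈ : ∀ {π} → π ∈ Snr n r → Φ π ∈ Snr n r
  Φ∈ {π} π∈ with ∈-Snr⁻ n r π∈
  ... | π∈perms , sorted =
    ∈-Snr⁺ n r (↭⇒∈-perms n (↭-trans (Φ-↭ π) (∈-perms⇒↭ n π∈perms)))
               (Equivalence.from (Φ-sorted⇔sorted n r (unique π∈)) sorted)
  Ψ∈ : ∀ {π} → π ∈ Snr n r → Ψ π ∈ Snr n r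
  Ψ∈ {π} π∈ with ∈-Snr⁻ n r π∈
  ... | π∈perms , sorted =
    ∈-Snr⁺ n r (↭⇒∈-perms n (↭-trans (Ψ-↭ π) (∈-perms⇒↭ n π∈perms)))
               (Equivalence.to (Φ-sorted⇔sorted n r (Unique-resp-↭ (↭-sym (Ψ-↭ π)) (unique π∈)))
                               (subst (λ w → iterate r S w ≡ idPerm n) (sym (Φ∘Ψ (unique π∈))) sorted))

corollary7p3 : (n : ℕ) → 1 ≤ n → (r k : ℕ) →
    countStat veh k (Snr n r) ≡ countStat des k (Snr n r)
corollary7p3 n _ r k = begin
  countStat veh k (Snr n r)          ≡⟨ countStat-map des veh Φ (Snr n r) (des∘Φ ∘ ∈-Snr⇒Unique n r) ⟨
  countStat des k (map Φ (Snr n r))  ≡⟨ countStat-↭ des (map-Φ-Snr n r) ⟩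
  countStat des k (Snr n r)          ∎
  where open ≡-Reasoning
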